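{- Let $\mathcal{G}$ be a graph class that is closed under taking the disjoint union with any complete graph, and let $k\ge 0$ and $m\ge 2$ be integers. Then $c_k^{\mathcal{G}}(m)\le c_k^{\mathcal{G}}(m-1)+m(k+1)+1$.
   Context: All graphs are finite and simple. For a graph $G$ and an integer $k\ge 0$, a set $S\subseteq V(G)$ is $k$-sparse if every vertex of $S$ has at most $k$ neighbours in $S$, $k$-dense if every vertex of $S$ is non-adjacent to at most $k$ other vertices of $S$, and $k$-defective if it is $k$-sparse or $k$-dense. A $k$-defective $m$-cocoloring of $G$ is a partition of $V(G)$ into at most $m$ sets each of which is $k$-defective. For a graph class $\mathcal{G}$, $c_k^{\mathcal{G}}(m)$ is the maximum integer $n$ such that every graph in $\mathcal{G}$ on at most $n$ vertices has a $k$-defective $m$-cocoloring. -}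

module Defs where

open import Data.Nat using (ℕ; _+_; _*_; _∸_; _≤_)
open import Data.Bool using (Bool; true; false; not; _∧_; if_then_else_)
open import Data.Fin using (Fin; splitAt; _≟_)
open import Data.Nat as ℕ using ()

open import Data.Sum using (_⊎_; inj₁; inj₂)
open import Data.Product using (Σ; _×_; _,_)
open import Relation.Nullary using (¬_; yes; no)
open import Relation.Nullary.Decidable using (⌊_⌋)
open import Relation.Binary.PropositionalEquality using (_≡_; refl)

record Graph (n : ℕ) : Set where
  field
    adj   : Fin n → Fin n → Bool
    sym   : ∀ x y → adj x y ≡ adj y x
    irrefl : ∀ x → adj x x ≡ false
open Graph public

count : ∀ {n} → (Fin n → Bool) → ℕ
count {ℕ.zero}  f = 0
count {ℕ.suc n} f = (if f Fin.zero then 1 else 0) + count (λ i → f (Fin.suc i))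

GraphClass : Set₁
GraphClass = ∀ n → Graph n → Set

-- Disjoint union of G with the complete graph K_t
-- (vertices of G first, then those of K_t).
unionAdj : ∀ {n} t → Graph n → Fin (n + t) → Fin (n + t) → Bool
unionAdj {n} t G x y with splitAt n x | splitAt n y
... | inj₁ a | inj₁ b = adj G a b
... | inj₂ a | inj₂ b = not ⌊ a ≟ b ⌋
... | inj₁ _ | inj₂ _ = false
... | inj₂ _ | inj₁ _ = false

notDecSym : ∀ {t} (a b : Fin t) → not ⌊ a ≟ b ⌋ ≡ not ⌊ b ≟ a ⌋
notDecSym a b with a ≟ b | b ≟ a
... | yes _ | yes _ = refl
... | no _  | no _  = refl
... | yes refl | no q with q refl
...   | ()
notDecSym a b | no p | yes refl with p refl
...   | ()

unionSym : ∀ {n} t (G : Graph n) x y → unionAdj t G x y ≡ unionAdj t G y x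
unionSym {n} t G x y with splitAt n x | splitAt n y
... | inj₁ a | inj₁ b = sym G a b
... | inj₂ a | inj₂ b = notDecSym a b
... | inj₁ _ | inj₂ _ = refl
... | inj₂ _ | inj₁ _ = refl

notDecRefl : ∀ {t} (a : Fin t) → not ⌊ a ≟ a ⌋ ≡ false
notDecRefl a with a ≟ a
... | yes _ = refl
... | no p with p refl
...   | ()

unionIrrefl : ∀ {n} t (G : Graph n) x → unionAdj t G x x ≡ false
unionIrrefl {n} t G x with splitAt n x
... | inj₁ a = irrefl G a
... | inj₂ a = notDecRefl a

_⊕K_ : ∀ {n} → Graph n → (t : ℕ) → Graph (n + t)
G ⊕K t = record { adj = unionAdj t G ; sym = unionSym t G ; irrefl = unionIrrefl t G }

ClosedUnderUnionWithComplete : GraphClass → Set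
ClosedUnderUnionWithComplete 𝒢 = ∀ n (G : Graph n) t → 𝒢 n G → 𝒢 (n + t) (G ⊕K t)

nbrsIn : ∀ {n} → Graph n → (Fin n → Bool) → Fin n → ℕ
nbrsIn G S u = count (λ v → S v ∧ adj G u v)

nonNbrsIn : ∀ {n} → Graph n → (Fin n → Bool) → Fin n → ℕ
nonNbrsIn G S u = count (λ v → S v ∧ (not ⌊ u ≟ v ⌋ ∧ not (adj G u v)))

Sparse : ∀ {n} → ℕ → Graph n → (Fin n → Bool) → Set
Sparse k G S = ∀ u → S u ≡ true → nbrsIn G S u ≤ k

Dense : ∀ {n} → ℕ → Graph n → (Fin n → Bool) → Set
Dense k G S = ∀ u → S u ≡ true → nonNbrsIn G S u ≤ k

Defective : ∀ {n} → ℕ → Graph n → (Fin n → Bool) → Set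
Defective k G S = Sparse k G S ⊎ Dense k G S

-- A k-defective m-cocoloring: a map c : V(G) → Fin m (a partition into at
-- most m sets, the colour classes, some possibly empty) such that every
-- colour class is k-defective.
colourClass : ∀ {n m} → (Fin n → Fin m) → Fin m → Fin n → Bool
colourClass c i v = ⌊ c v ≟ i ⌋

HasCocoloring : ∀ {n} → ℕ → ℕ → Graph n → Set
HasCocoloring {n} k m G =
  Σ (Fin n → Fin m) λ c → ∀ i → Defective k G (colourClass c i)

AllCocolorable : GraphClass → ℕ → ℕ → ℕ → Set
AllCocolorable 𝒢 k m N = ∀ n (G : Graph n) → n ≤ N → 𝒢 n G → HasCocoloring k m G

-- "c_k^𝒢(m) = N": N is the maximum integer with AllCocolorable 𝒢 k m N
-- (the property is downward closed in N, so this is the maximum).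
IsC : GraphClass → ℕ → ℕ → ℕ → Set
IsC 𝒢 k m N = AllCocolorable 𝒢 k m N × ¬ AllCocolorable 𝒢 k m (ℕ.suc N)

-- Suppose a > b + m(k+1) + 1. Take G ∈ 𝒢 on at most b + 1 vertices; then G ⊕ K_t with
-- t = m(k+1) + 1 lies in 𝒢 and has at most a vertices, so it has a k-defective
-- m-cocoloring. By pigeonhole some colour class contains k + 2 vertices of K_t. Such a
-- class is not k-sparse, hence k-dense, and so contains no vertex of G (each would have
-- k + 2 non-neighbours in it). Deleting that colour leaves a k-defective
-- (m-1)-cocoloring of G; as G was arbitrary, this contradicts the maximality of b.
{-# OPTIONS --safe #-}
module Submission where

open import Defs hiding (sym)
open import Data.Nat using (ℕ; _+_; _*_; _∸_; _≤_)
open import Data.Nat as ℕ using (zero; suc; _<_; z≤n; z<s; s≤s⁻¹)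
open import Data.Nat.Properties hiding (_≟_)
open import Data.Bool using (Bool; true; false; not; _∧_; if_then_else_)
open import Data.Bool.Properties using (∧-identityʳ)
open import Data.Fin as Fin using (Fin; splitAt; _≟_; _↑ˡ_; _↑ʳ_; punchIn; punchOut)
open import Data.Fin.Properties
  using (any?; splitAt-↑ˡ; splitAt-↑ʳ; ↑ˡ-injective; punchIn-punchOut; punchIn-injective)
open import Data.Sum using (inj₁; inj₂)
open import Data.Product using (_,_; proj₁; proj₂; ∃-syntax)
open import Function using (_∘_; _⇔_; mk⇔)
open import Relation.Nullary using (¬_; Dec; contradiction)
open import Relation.Nullary.Decidable using (⌊_⌋; isYes≗does; does-⇔; dec-true; dec-false; ⌊⌋-map′; decidable-stable)
open import Relation.Binary.PropositionalEquality
  using (_≡_; _≢_; _≗_; refl; sym; trans; cong; cong₂; subst; module ≡-Reasoning)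
open import Algebra.Properties.CommutativeMonoid.Sum +-0-commutativeMonoid
  using (sum; sum-cong-≗; ∑-distrib-+)

𝟙 : Bool → ℕ
𝟙 b = if b then 1 else 0

∑-mono-≤ : ∀ {m} {f g : Fin m → ℕ} → (∀ i → f i ≤ g i) → sum f ≤ sum g
∑-mono-≤ {zero}  f≤g = z≤n
∑-mono-≤ {suc m} f≤g = +-mono-≤ (f≤g Fin.zero) (∑-mono-≤ (f≤g ∘ Fin.suc))

∑-const : ∀ m c → sum {m} (λ _ → c) ≡ m * c
∑-const zero    c = refl
∑-const (suc m) c = cong (c +_) (∑-const m c)

∑-𝟙-≟ : ∀ {m} (x : Fin m) → sum (λ i → 𝟙 ⌊ x ≟ i ⌋) ≡ 1
∑-𝟙-≟ {suc m} Fin.zero    = cong suc (trans (∑-const m 0) (*-zeroʳ m))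
∑-𝟙-≟ {suc m} (Fin.suc x) = trans (sum-cong-≗ (λ i → cong 𝟙 (⌊⌋-map′ _ _ (x ≟ i)))) (∑-𝟙-≟ x)

pigeonhole : ∀ {m} c (f : Fin m → ℕ) → m * c < sum f → ∃[ i ] c < f i
pigeonhole {m} c f m*c<∑f = decidable-stable (any? (λ i → c ℕ.<? f i)) λ none →
  <⇒≱ m*c<∑f (begin
    sum f               ≤⟨ ∑-mono-≤ (λ i → ≮⇒≥ (none ∘ (i ,_))) ⟩
    sum {m} (λ _ → c)   ≡⟨ ∑-const m c ⟩
    m * c               ∎)
  where open ≤-Reasoning

count≡∑𝟙 : ∀ {n} (f : Fin n → Bool) → count f ≡ sum (𝟙 ∘ f)
count≡∑𝟙 {zero}  f = refl
count≡∑𝟙 {suc n} f = cong (𝟙 (f Fin.zero) +_) (count≡∑𝟙 (f ∘ Fin.suc))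

count-cong : ∀ {n} {f g : Fin n → Bool} → f ≗ g → count f ≡ count g
count-cong {zero}  f≗g = refl
count-cong {suc n} f≗g = cong₂ _+_ (cong 𝟙 (f≗g Fin.zero)) (count-cong (f≗g ∘ Fin.suc))

count-witness : ∀ {n} (f : Fin n → Bool) → 0 < count f → ∃[ x ] f x ≡ true
count-witness {suc n} f 0<count with f Fin.zero in f0
... | true  = Fin.zero , f0
... | false with x , fx ← count-witness (f ∘ Fin.suc) 0<count = Fin.suc x , fx

count-≤-1+count-without : ∀ {n} (f : Fin n → Bool) (u : Fin n) →
                          count f ≤ 1 + count (λ v → f v ∧ not ⌊ u ≟ v ⌋)
count-≤-1+count-without f u = begin
  count f                                             ≡⟨ count≡∑𝟙 f ⟩
  sum (𝟙 ∘ f)                                         ≤⟨ ∑-mono-≤ (λ v → 𝟙-≤ (f v) ⌊ u ≟ v ⌋) ⟩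
  sum (λ v → 𝟙 ⌊ u ≟ v ⌋ + 𝟙 (f v ∧ not ⌊ u ≟ v ⌋))
    ≡⟨ ∑-distrib-+ (λ v → 𝟙 ⌊ u ≟ v ⌋) (λ v → 𝟙 (f v ∧ not ⌊ u ≟ v ⌋)) ⟩
  sum (λ v → 𝟙 ⌊ u ≟ v ⌋) + sum (λ v → 𝟙 (f v ∧ not ⌊ u ≟ v ⌋))
    ≡⟨ cong₂ _+_ (∑-𝟙-≟ u) (sym (count≡∑𝟙 (λ v → f v ∧ not ⌊ u ≟ v ⌋))) ⟩
  1 + count (λ v → f v ∧ not ⌊ u ≟ v ⌋)                ∎
  where
  open ≤-Reasoning
  𝟙-≤ : ∀ a b → 𝟙 a ≤ 𝟙 b + 𝟙 (a ∧ not b)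
  𝟙-≤ false _     = z≤n
  𝟙-≤ true  true  = ≤-refl
  𝟙-≤ true  false = ≤-refl

∑-fibre-sizes : ∀ {t m} (c : Fin t → Fin m) → sum (λ i → count (λ v → ⌊ c v ≟ i ⌋)) ≡ t
∑-fibre-sizes {zero}  {m} c = trans (∑-const m 0) (*-zeroʳ m)
∑-fibre-sizes {suc t} c = begin
  sum (λ i → 𝟙 ⌊ c Fin.zero ≟ i ⌋ + count (λ v → ⌊ c (Fin.suc v) ≟ i ⌋))
    ≡⟨ ∑-distrib-+ (λ i → 𝟙 ⌊ c Fin.zero ≟ i ⌋) (λ i → count (λ v → ⌊ c (Fin.suc v) ≟ i ⌋)) ⟩
  sum (λ i → 𝟙 ⌊ c Fin.zero ≟ i ⌋) + sum (λ i → count (λ v → ⌊ c (Fin.suc v) ≟ i ⌋))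
    ≡⟨ cong₂ _+_ (∑-𝟙-≟ (c Fin.zero)) (∑-fibre-sizes (c ∘ Fin.suc)) ⟩
  suc t                                                                     ∎
  where open ≡-Reasoning

count-↑ˡ+count-↑ʳ : ∀ n t (f : Fin (n + t) → Bool) →
                    count f ≡ count (λ a → f (a ↑ˡ t)) + count (λ v → f (n ↑ʳ v))
count-↑ˡ+count-↑ʳ zero    t f = refl
count-↑ˡ+count-↑ʳ (suc n) t f =
  trans (cong (𝟙 (f Fin.zero) +_) (count-↑ˡ+count-↑ʳ n t (f ∘ Fin.suc))) (sym (+-assoc (𝟙 (f Fin.zero)) _ _))

count-↑ˡ-≤ : ∀ n t (f : Fin (n + t) → Bool) → count (λ a → f (a ↑ˡ t)) ≤ count f
count-↑ˡ-≤ n t f = ≤-trans (m≤m+n _ _) (≤-reflexive (sym (count-↑ˡ+count-↑ʳ n t f)))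

count-↑ʳ-≤ : ∀ n t (f : Fin (n + t) → Bool) → count (λ v → f (n ↑ʳ v)) ≤ count f
count-↑ʳ-≤ n t f = ≤-trans (m≤n+m _ _) (≤-reflexive (sym (count-↑ˡ+count-↑ʳ n t f)))

⌊⌋-⇔ : ∀ {a b} {A : Set a} {B : Set b} → A ⇔ B → (a? : Dec A) (b? : Dec B) → ⌊ a? ⌋ ≡ ⌊ b? ⌋
⌊⌋-⇔ A⇔B a? b? = trans (isYes≗does a?) (trans (does-⇔ A⇔B a? b?) (sym (isYes≗does b?)))

⌊⌋-false : ∀ {a} {A : Set a} (a? : Dec A) → ¬ A → ⌊ a? ⌋ ≡ false
⌊⌋-false a? ¬a = trans (isYes≗does a?) (dec-false a? ¬a)

⌊⌋-true : ∀ {a} {A : Set a} (a? : Dec A) → A → ⌊ a? ⌋ ≡ true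
⌊⌋-true a? a = trans (isYes≗does a?) (dec-true a? a)

↑ˡ≢↑ʳ : ∀ {n t} (a : Fin n) (v : Fin t) → a ↑ˡ t ≢ n ↑ʳ v
↑ˡ≢↑ʳ {n} {t} a v eq
  with () ← trans (sym (splitAt-↑ˡ n a t)) (trans (cong (splitAt n) eq) (splitAt-↑ʳ n t v))

⌊↑ˡ≟↑ˡ⌋ : ∀ {n} t (a b : Fin n) → ⌊ a ↑ˡ t ≟ b ↑ˡ t ⌋ ≡ ⌊ a ≟ b ⌋
⌊↑ˡ≟↑ˡ⌋ t a b = ⌊⌋-⇔ (mk⇔ (↑ˡ-injective t a b) (cong (_↑ˡ t))) (a ↑ˡ t ≟ b ↑ˡ t) (a ≟ b)

Defective-cong : ∀ {n k} {G : Graph n} {S T : Fin n → Bool} → S ≗ T → Defective k G S → Defective k G T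
Defective-cong {G = G} S≗T (inj₁ sparse) = inj₁ λ u Tu →
  subst (_≤ _) (count-cong (λ v → cong (_∧ adj G u v) (S≗T v))) (sparse u (trans (S≗T u) Tu))
Defective-cong {G = G} S≗T (inj₂ dense) = inj₂ λ u Tu →
  subst (_≤ _) (count-cong (λ v → cong (_∧ _) (S≗T v))) (dense u (trans (S≗T u) Tu))

drop-unused-colour : ∀ {n k m} {G : Graph n} (c : Fin n → Fin (suc m)) (i : Fin (suc m)) →
                     (∀ v → c v ≢ i) → (∀ j → Defective k G (colourClass c j)) → HasCocoloring k m G
drop-unused-colour {n} {m = m} {G} c i unused defective =
  c′ , λ j → Defective-cong {G = G} (classes j) (defective (punchIn i j))
  where
  c′ : Fin n → Fin m
  c′ v = punchOut (unused v ∘ sym)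
  classes : ∀ j → colourClass c (punchIn i j) ≗ colourClass c′ j
  classes j v = ⌊⌋-⇔ (mk⇔ (λ eq → punchIn-injective i _ _ (trans (punchIn-punchOut _) eq))
                          (λ eq → trans (sym (punchIn-punchOut _)) (cong (punchIn i) eq)))
                     (c v ≟ punchIn i j) (c′ v ≟ j)

module _ {n : ℕ} (G : Graph n) (t : ℕ) where

  adj-⊕K-↑ˡ : ∀ a b → adj (G ⊕K t) (a ↑ˡ t) (b ↑ˡ t) ≡ adj G a b
  adj-⊕K-↑ˡ a b rewrite splitAt-↑ˡ n a t | splitAt-↑ˡ n b t = refl

  adj-⊕K-↑ˡ↑ʳ : ∀ a v → adj (G ⊕K t) (a ↑ˡ t) (n ↑ʳ v) ≡ false
  adj-⊕K-↑ˡ↑ʳ a v rewrite splitAt-↑ˡ n a t | splitAt-↑ʳ n t v = refl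

  adj-⊕K-↑ʳ : ∀ u v → adj (G ⊕K t) (n ↑ʳ u) (n ↑ʳ v) ≡ not ⌊ u ≟ v ⌋
  adj-⊕K-↑ʳ u v rewrite splitAt-↑ʳ n t u | splitAt-↑ʳ n t v = refl

  Defective-↑ˡ : ∀ {k S} → Defective k (G ⊕K t) S → Defective k G (λ a → S (a ↑ˡ t))
  Defective-↑ˡ {S = S} (inj₁ sparse) = inj₁ λ u Su → begin
    count (λ b → S (b ↑ˡ t) ∧ adj G u b)
      ≡⟨ count-cong (λ b → cong (S (b ↑ˡ t) ∧_) (sym (adj-⊕K-↑ˡ u b))) ⟩
    count (λ b → S (b ↑ˡ t) ∧ adj (G ⊕K t) (u ↑ˡ t) (b ↑ˡ t))
      ≤⟨ count-↑ˡ-≤ n t _ ⟩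
    nbrsIn (G ⊕K t) S (u ↑ˡ t)
      ≤⟨ sparse (u ↑ˡ t) Su ⟩
    _ ∎
    where open ≤-Reasoning
  Defective-↑ˡ {S = S} (inj₂ dense) = inj₂ λ u Su → begin
    count (λ b → S (b ↑ˡ t) ∧ (not ⌊ u ≟ b ⌋ ∧ not (adj G u b)))
      ≡⟨ count-cong (λ b → cong₂ (λ p q → S (b ↑ˡ t) ∧ (not p ∧ not q))
                                 (sym (⌊↑ˡ≟↑ˡ⌋ t u b)) (sym (adj-⊕K-↑ˡ u b))) ⟩
    count (λ b → S (b ↑ˡ t) ∧ (not ⌊ u ↑ˡ t ≟ b ↑ˡ t ⌋ ∧ not (adj (G ⊕K t) (u ↑ˡ t) (b ↑ˡ t))))
      ≤⟨ count-↑ˡ-≤ n t _ ⟩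
    nonNbrsIn (G ⊕K t) S (u ↑ˡ t)
      ≤⟨ dense (u ↑ˡ t) Su ⟩
    _ ∎
    where open ≤-Reasoning

  large-K-part⇒¬Sparse : ∀ {k S} → suc k < count (λ v → S (n ↑ʳ v)) → ¬ Sparse k (G ⊕K t) S
  large-K-part⇒¬Sparse {k} {S} large sparse = n≮n k (begin-strict
    k
      <⟨ s≤s⁻¹ (≤-trans large (count-≤-1+count-without (λ v → S (n ↑ʳ v)) u)) ⟩
    count (λ v → S (n ↑ʳ v) ∧ not ⌊ u ≟ v ⌋)
      ≡⟨ count-cong (λ v → cong (S (n ↑ʳ v) ∧_) (sym (adj-⊕K-↑ʳ u v))) ⟩
    count (λ v → S (n ↑ʳ v) ∧ adj (G ⊕K t) (n ↑ʳ u) (n ↑ʳ v))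
      ≤⟨ count-↑ʳ-≤ n t _ ⟩
    nbrsIn (G ⊕K t) S (n ↑ʳ u)
      ≤⟨ sparse (n ↑ʳ u) Su ⟩
    k ∎)
    where
    open ≤-Reasoning
    member : ∃[ u ] S (n ↑ʳ u) ≡ true
    member = count-witness (λ v → S (n ↑ʳ v)) (<-≤-trans z<s (<⇒≤ large))
    u : Fin t
    u = proj₁ member
    Su : S (n ↑ʳ u) ≡ true
    Su = proj₂ member

  Dense⇒disjoint-from-G : ∀ {k S} → k < count (λ v → S (n ↑ʳ v)) → Dense k (G ⊕K t) S →
                          ∀ a → S (a ↑ˡ t) ≢ true
  Dense⇒disjoint-from-G {k} {S} large dense a Sa = n≮n k (begin-strict
    k
      <⟨ large ⟩
    count (λ v → S (n ↑ʳ v))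
      ≡⟨ count-cong (λ v → sym (trans (cong₂ (λ p q → S (n ↑ʳ v) ∧ (not p ∧ not q))
                                            (⌊⌋-false (a ↑ˡ t ≟ n ↑ʳ v) (↑ˡ≢↑ʳ a v))
                                            (adj-⊕K-↑ˡ↑ʳ a v))
                                     (∧-identityʳ _))) ⟩
    count (λ v → S (n ↑ʳ v) ∧ (not ⌊ a ↑ˡ t ≟ n ↑ʳ v ⌋ ∧ not (adj (G ⊕K t) (a ↑ˡ t) (n ↑ʳ v))))
      ≤⟨ count-↑ʳ-≤ n t _ ⟩
    nonNbrsIn (G ⊕K t) S (a ↑ˡ t)
      ≤⟨ dense (a ↑ˡ t) Sa ⟩
    k ∎)
    where open ≤-Reasoning

  colour-unused-on-G : ∀ {k m} (c : Fin (n + t) → Fin m) →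
                       (∀ i → Defective k (G ⊕K t) (colourClass c i)) → m * suc k < t →
                       ∃[ i ] ∀ a → c (a ↑ˡ t) ≢ i
  colour-unused-on-G {k} {m} c defective m*[1+k]<t = i , avoids (defective i)
    where
    crowded : ∃[ i ] suc k < count (λ v → ⌊ c (n ↑ʳ v) ≟ i ⌋)
    crowded = pigeonhole (suc k) (λ i → count (λ v → ⌊ c (n ↑ʳ v) ≟ i ⌋))
                (subst (m * suc k <_) (sym (∑-fibre-sizes (c ∘ (n ↑ʳ_)))) m*[1+k]<t)
    i : Fin m
    i = proj₁ crowded
    large : suc k < count (λ v → ⌊ c (n ↑ʳ v) ≟ i ⌋)
    large = proj₂ crowded
    avoids : Defective k (G ⊕K t) (colourClass c i) → ∀ a → c (a ↑ˡ t) ≢ i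
    avoids (inj₁ sparse) = contradiction sparse (large-K-part⇒¬Sparse large)
    avoids (inj₂ dense) a ca≡i =
      Dense⇒disjoint-from-G (<-trans (n<1+n k) large) dense a (⌊⌋-true (c (a ↑ˡ t) ≟ i) ca≡i)

  HasCocoloring-⊕K⇒ : ∀ {k m} → suc m * suc k < t →
                   HasCocoloring k (suc m) (G ⊕K t) → HasCocoloring k m G
  HasCocoloring-⊕K⇒ {k} {m} bound (c , defective) =
    drop-unused-colour {G = G} (c ∘ (_↑ˡ t)) i unused (λ j → Defective-↑ˡ (defective j))
    where
    unused-colour : ∃[ i ] ∀ a → c (a ↑ˡ t) ≢ i
    unused-colour = colour-unused-on-G c defective bound
    i : Fin (suc m)
    i = proj₁ unused-colour
    unused : ∀ a → c (a ↑ˡ t) ≢ i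
    unused = proj₂ unused-colour

lemma6p3 : (𝒢 : GraphClass) → ClosedUnderUnionWithComplete 𝒢 →
    ∀ (k m : ℕ) → 2 ≤ m → ∀ (a b : ℕ) →
    IsC 𝒢 k m a → IsC 𝒢 k (m ∸ 1) b →
    a ≤ b + m * (k + 1) + 1
lemma6p3 𝒢 closed k zero    () a b
lemma6p3 𝒢 closed k (suc m) _  a b (cocolourable-a , _) (_ , ¬cocolourable-1+b) =
  ≮⇒≥ λ bound<a → ¬cocolourable-1+b λ n G n≤1+b G∈𝒢 →
    HasCocoloring-⊕K⇒ G t t-large
      (cocolourable-a (n + t) (G ⊕K t) (fits n≤1+b bound<a) (closed n G t G∈𝒢))
  where
  t : ℕ
  t = suc m * (k + 1) + 1
  t-large : suc m * suc k < t
  t-large = ≤-reflexive (trans (+-comm 1 _) (cong (λ x → suc m * x + 1) (+-comm 1 k)))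
  fits : ∀ {n} → n ≤ suc b → b + suc m * (k + 1) + 1 < a → n + t ≤ a
  fits {n} n≤1+b bound<a = begin
    n + t                         ≤⟨ +-monoˡ-≤ t n≤1+b ⟩
    suc (b + t)                   ≡⟨ cong suc (sym (+-assoc b (suc m * (k + 1)) 1)) ⟩
    suc (b + suc m * (k + 1) + 1) ≤⟨ bound<a ⟩
    a                             ∎
    where open ≤-Reasoning
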